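{- Let $X\subseteq\mathbb{N}$ be such that every element of $\mathbb{N}\setminus X$ lies in some gap of $X$, i.e. for every $n\notin X$ there are natural numbers $e\le i$ such that $X$ has a gap of size $2^{ -e}$ at $P_i$ and $n$ is among the last $2^{i-e}$ elements of $P_i$. Then $X$ has density 1 if and only if for every $e\in\mathbb{N}$ there are only finitely many $i$ such that $X$ has a gap of size $2^{ -e}$ at $P_i$.
   Context: For $i\in\mathbb{N}$ let $P_i=\{n\in\mathbb{N}: 2^i\le n<2^{i+1}\}$. For natural numbers $e\le i$, $X\subseteq\mathbb{N}$ has a gap of size $2^{ -e}$ at $P_i$ if none of the last $2^{i-e}$ elements of $P_i$ (i.e. the largest $2^{i-e}$ elements of $P_i$) belongs to $X$. A set $X$ has density 1 if $\lim_{n\to\infty}\frac{|X\cap\{0,\dots,n-1\}|}{n}=1$. -}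

module Defs where

open import Data.Bool using (Bool; true; false; if_then_else_)
open import Data.Nat using (ℕ; zero; suc; _+_; _∸_; _^_; _≤_; _<_)
open import Data.Integer using (+_)
open import Data.Rational using (ℚ; _/_; ∣_∣; _-_; 1ℚ; 0ℚ) renaming (_<_ to _<ℚ_)
open import Data.Product using (_×_; ∃-syntax)
open import Relation.Binary.PropositionalEquality using (_≡_)

Subset : Set
Subset = ℕ → Bool

-- n is among the last 2^(i-e) elements of P_i = [2^i, 2^(i+1))
InLast : ℕ → ℕ → ℕ → Set
InLast e i n = (2 ^ suc i ∸ 2 ^ (i ∸ e) ≤ n) × (n < 2 ^ suc i)

Gap : Subset → ℕ → ℕ → Set
Gap X e i = (e ≤ i) × (∀ n → InLast e i n → X n ≡ false)

count : Subset → ℕ → ℕ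
count X zero = 0
count X (suc n) = count X n + (if X n then 1 else 0)

-- lim_{n→∞} |X ∩ {0..n-1}| / n = 1   (n ranges over suc m to avoid division by 0)
Density1 : Subset → Set
Density1 X = ∀ (ε : ℚ) → 0ℚ <ℚ ε →
  ∃[ N ] ∀ m → N ≤ m → ∣ ((+ count X (suc m)) / suc m) - 1ℚ ∣ <ℚ ε

GapsCoverComplement : Subset → Set
GapsCoverComplement X =
  ∀ n → X n ≡ false → ∃[ e ] ∃[ i ] (Gap X e i × InLast e i n)

FinitelyManyGaps : Subset → ℕ → Set
FinitelyManyGaps X e = ∃[ B ] ∀ i → Gap X e i → i < B

-- Let c n be the number of non-elements of X below n.  A gap of size 2^-e at
-- P_i alone puts 2^(i-e) non-elements below 2^(i+1), a fixed fraction 2^-(e+1),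
-- so density 1 leaves room for only finitely many such gaps.  Conversely, a
-- gap lies inside a single block P_i; so once the finitely many gaps of size
-- larger than 2^-f are left behind (beyond the block P_J), every
-- non-element of a block P_j sits among its last 2^(j-f) elements, because it
-- lies in some gap.  Summing over blocks gives c n · 2^f ≤ 2^(J+f) + 2n, hence
-- c n / n is eventually below 2^(1-f).
module Submission where

open import Defs
open import Data.Bool using (true; false; not)
open import Data.Nat
open import Data.Nat.Properties
open import Data.Nat.Solver using (module +-*-Solver)
open import Data.Integer as ℤ using (+_; -[1+_])
import Data.Integer.Properties as ℤ
open import Data.Integer.Solver renaming (module +-*-Solver to ℤ-Solver)
import Data.Rational as ℚ
import Data.Rational.Properties as ℚ
open import Data.Rational.Unnormalised as ℚᵘ using (mkℚᵘ; *<*) renaming (_≃_ to _≃ᵘ_)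
import Data.Rational.Unnormalised.Properties as ℚᵘ
open import Data.Product using (_×_; _,_; proj₁; ∃-syntax)
open import Data.Sum using (inj₁; inj₂)
open import Function using (_∘_)
open import Function.Bundles using (_⇔_; mk⇔; Equivalence)
open import Relation.Nullary using (yes; no; contradiction)
open import Relation.Binary.PropositionalEquality using (_≡_; refl; sym; trans; cong; cong₂; subst; subst₂; module ≡-Reasoning)

∁ : Subset → Subset
∁ X = not ∘ X

-- Upper density 0, with ε = 1/(k+1).
Density0 : Subset → Set
Density0 Y = ∀ k → ∃[ N ] ∀ n → N ≤ n → count Y n * suc k < n

-- Counting

count-suc-≤ : ∀ Y n → count Y (suc n) ≤ suc (count Y n)
count-suc-≤ Y n with Y n
... | true  = ≤-reflexive (+-comm (count Y n) 1)
... | false = ≤-trans (≤-reflexive (+-identityʳ (count Y n))) (n≤1+n _)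

count-≤ : ∀ Y n → count Y n ≤ n
count-≤ Y zero    = z≤n
count-≤ Y (suc n) = ≤-trans (count-suc-≤ Y n) (s≤s (count-≤ Y n))

count-+-≤ : ∀ Y d a → count Y (d + a) ≤ d + count Y a
count-+-≤ Y zero    a = ≤-refl
count-+-≤ Y (suc d) a = ≤-trans (count-suc-≤ Y (d + a)) (s≤s (count-+-≤ Y d a))

count-≤-+ : ∀ Y d a → count Y a ≤ count Y (d + a)
count-≤-+ Y zero    a = ≤-refl
count-≤-+ Y (suc d) a = ≤-trans (count-≤-+ Y d a) (m≤m+n _ _)

count-mono : ∀ Y {m n} → m ≤ n → count Y m ≤ count Y n
count-mono Y {m} {n} m≤n = subst (λ k → count Y m ≤ count Y k) (m∸n+n≡m m≤n) (count-≤-+ Y (n ∸ m) m)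

count-false-on : ∀ Y d a → (∀ n → a ≤ n → n < d + a → Y n ≡ false) → count Y (d + a) ≡ count Y a
count-false-on Y zero    a _ = refl
count-false-on Y (suc d) a h rewrite h (d + a) (m≤n+m a d) ≤-refl =
  trans (+-identityʳ _) (count-false-on Y d a (λ n a≤n n<d+a → h n a≤n (m<n⇒m<1+n n<d+a)))

count-true-on : ∀ Y d a → (∀ n → a ≤ n → n < d + a → Y n ≡ true) → count Y (d + a) ≡ d + count Y a
count-true-on Y zero    a _ = refl
count-true-on Y (suc d) a h rewrite h (d + a) (m≤n+m a d) ≤-refl =
  trans (+-comm _ 1) (cong suc (count-true-on Y d a (λ n a≤n n<d+a → h n a≤n (m<n⇒m<1+n n<d+a))))

count+count-∁ : ∀ X n → count X n + count (∁ X) n ≡ n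
count+count-∁ X zero    = refl
count+count-∁ X (suc n) with X n
... | true  = trans (solve 2 (λ a b → (a :+ con 1) :+ (b :+ con 0) := con 1 :+ (a :+ b)) refl (count X n) (count (∁ X) n))
                    (cong suc (count+count-∁ X n))
  where open +-*-Solver
... | false = trans (solve 2 (λ a b → (a :+ con 0) :+ (b :+ con 1) := con 1 :+ (a :+ b)) refl (count X n) (count (∁ X) n))
                    (cong suc (count+count-∁ X n))
  where open +-*-Solver

-- Rational densities

∣a/[1+m]-1∣≃c/[1+m] : ∀ a c m → a + c ≡ suc m →
  ℚ.toℚᵘ ℚ.∣ (+ a) ℚ./ suc m ℚ.- ℚ.1ℚ ∣ ≃ᵘ mkℚᵘ (+ c) m
∣a/[1+m]-1∣≃c/[1+m] a c m a+c≡1+m =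
  ℚᵘ.≃-trans (ℚ.toℚᵘ-homo-∣-∣ (a/[1+m] ℚ.- ℚ.1ℚ))
  (ℚᵘ.≃-trans (ℚᵘ.∣-∣-cong (ℚᵘ.≃-trans (ℚ.toℚᵘ-homo-+ a/[1+m] (ℚ.- ℚ.1ℚ))
                                       (ℚᵘ.+-cong (ℚ.toℚᵘ-fromℚᵘ (mkℚᵘ (+ a) m)) ℚᵘ.≃-refl)))
  (ℚᵘ.≃-reflexive (cong₂ mkℚᵘ ∣numerator∣ (*-identityʳ m))))
  where
  a/[1+m] = (+ a) ℚ./ suc m

  numerator : + a ℤ.* + 1 ℤ.+ -[1+ 0 ] ℤ.* + suc m ≡ ℤ.- (+ c)
  numerator = begin
    + a ℤ.* + 1 ℤ.+ -[1+ 0 ] ℤ.* + suc m        ≡⟨ cong (λ z → + a ℤ.* + 1 ℤ.+ -[1+ 0 ] ℤ.* z) 1+m≡a+c ⟩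
    + a ℤ.* + 1 ℤ.+ -[1+ 0 ] ℤ.* (+ a ℤ.+ + c)  ≡⟨ solve 2 (λ x y → x :* con (+ 1) :+ con -[1+ 0 ] :* (x :+ y) := :- y)
                                                    refl (+ a) (+ c) ⟩
    ℤ.- (+ c)                                   ∎
    where
    open ℤ-Solver
    open ≡-Reasoning
    1+m≡a+c : + suc m ≡ + a ℤ.+ + c
    1+m≡a+c = trans (cong +_ (sym a+c≡1+m)) (ℤ.pos-+ a c)

  ∣numerator∣ : + ℤ.∣ + a ℤ.* + 1 ℤ.+ -[1+ 0 ] ℤ.* + suc m ∣ ≡ + c
  ∣numerator∣ = trans (cong (+_ ∘ ℤ.∣_∣) numerator) (cong +_ (ℤ.∣-i∣≡∣i∣ (+ c)))

c/[1+m]<p/[1+k]⇔ : ∀ c m p k → mkℚᵘ (+ c) m ℚᵘ.< mkℚᵘ (+ p) k ⇔ c * suc k < p * suc m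
c/[1+m]<p/[1+k]⇔ c m p k = mk⇔
  (λ { (*<* lt) → ℤ.drop‿+<+ (subst₂ ℤ._<_ (sym (ℤ.pos-* c (suc k))) (sym (ℤ.pos-* p (suc m))) lt) })
  (λ lt → *<* (subst₂ ℤ._<_ (ℤ.pos-* c (suc k)) (ℤ.pos-* p (suc m)) (ℤ.+<+ lt)))

∣a/[1+m]-1∣<ε⇔ : ∀ {a c m ε p k} → a + c ≡ suc m → ℚ.toℚᵘ ε ≃ᵘ mkℚᵘ (+ p) k →
  ℚ.∣ (+ a) ℚ./ suc m ℚ.- ℚ.1ℚ ∣ ℚ.< ε ⇔ c * suc k < p * suc m
∣a/[1+m]-1∣<ε⇔ {a} {c} {m} {p = p} {k} a+c≡1+m ε≃p/[1+k] = mk⇔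
  (λ lt → to (ℚᵘ.<-respʳ-≃ ε≃p/[1+k] (ℚᵘ.<-respˡ-≃ distance (ℚ.toℚᵘ-mono-< lt))))
  (λ lt → ℚ.toℚᵘ-cancel-< (ℚᵘ.<-respʳ-≃ (ℚᵘ.≃-sym ε≃p/[1+k]) (ℚᵘ.<-respˡ-≃ (ℚᵘ.≃-sym distance) (from lt))))
  where
  open Equivalence (c/[1+m]<p/[1+k]⇔ c m p k)
  distance : ℚ.toℚᵘ ℚ.∣ (+ a) ℚ./ suc m ℚ.- ℚ.1ℚ ∣ ≃ᵘ mkℚᵘ (+ c) m
  distance = ∣a/[1+m]-1∣≃c/[1+m] a c m a+c≡1+m

positive-numerator : ∀ ε → ℚ.0ℚ ℚ.< ε → ∃[ p ] ∃[ k ] ℚ.toℚᵘ ε ≃ᵘ mkℚᵘ (+ suc p) k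
positive-numerator (ℚ.mkℚ (+ suc p) k _) _ = p , k , ℚᵘ.≃-refl
positive-numerator (ℚ.mkℚ (+ 0) _ _) 0<ε with ℚ.toℚᵘ-mono-< 0<ε
... | *<* (ℤ.+<+ ())
positive-numerator (ℚ.mkℚ -[1+ _ ] _ _) 0<ε with ℚ.toℚᵘ-mono-< 0<ε
... | *<* ()

0<1/[1+k] : ∀ k → ℚ.0ℚ ℚ.< (+ 1) ℚ./ suc k
0<1/[1+k] k = ℚ.toℚᵘ-cancel-<
  (ℚᵘ.<-respʳ-≃ (ℚᵘ.≃-sym (ℚ.toℚᵘ-fromℚᵘ (mkℚᵘ (+ 1) k))) (*<* (ℤ.+<+ (s≤s z≤n))))

Density1⇔Density0-∁ : ∀ X → Density1 X ⇔ Density0 (∁ X)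
Density1⇔Density0-∁ X = mk⇔ density1⇒ density0⇒
  where
  distance<ε⇔ : ∀ {m ε p k} → ℚ.toℚᵘ ε ≃ᵘ mkℚᵘ (+ p) k →
    ℚ.∣ (+ count X (suc m)) ℚ./ suc m ℚ.- ℚ.1ℚ ∣ ℚ.< ε ⇔ count (∁ X) (suc m) * suc k < p * suc m
  distance<ε⇔ {m} = ∣a/[1+m]-1∣<ε⇔ {count X (suc m)} {count (∁ X) (suc m)} (count+count-∁ X (suc m))

  density1⇒ : Density1 X → Density0 (∁ X)
  density1⇒ d1 k with d1 ((+ 1) ℚ./ suc k) (0<1/[1+k] k)
  ... | N , close = suc N , λ where
    (suc m) (s≤s N≤m) → subst (count (∁ X) (suc m) * suc k <_) (+-identityʳ (suc m))
      (Equivalence.to (distance<ε⇔ (ℚ.toℚᵘ-fromℚᵘ (mkℚᵘ (+ 1) k))) (close m N≤m))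

  density0⇒ : Density0 (∁ X) → Density1 X
  density0⇒ d0 ε 0<ε with positive-numerator ε 0<ε
  ... | p , k , ε≃ with d0 k
  ...   | N , sparse = N , λ m N≤m → Equivalence.from (distance<ε⇔ ε≃)
          (<-≤-trans (sparse (suc m) (m≤n⇒m≤1+n N≤m)) (m≤m+n (suc m) (p * suc m)))

-- Dyadic blocks

InBlock : ℕ → ℕ → Set
InBlock i n = 2 ^ i ≤ n × n < 2 ^ suc i

n<2^n : ∀ n → n < 2 ^ n
n<2^n zero    = s≤s z≤n
n<2^n (suc n) = +-mono-≤ (m^n>0 2 n) (≤-trans (n<2^n n) (m≤m+n (2 ^ n) 0))

2^[i∸e]≤2^[1+i] : ∀ i e → 2 ^ (i ∸ e) ≤ 2 ^ suc i
2^[i∸e]≤2^[1+i] i e = ^-monoʳ-≤ 2 (≤-trans (m∸n≤m i e) (n≤1+n i))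

2^[i∸e]*2^e≡2^i : ∀ {i e} → e ≤ i → 2 ^ (i ∸ e) * 2 ^ e ≡ 2 ^ i
2^[i∸e]*2^e≡2^i {i} {e} e≤i = trans (sym (^-distribˡ-+-* 2 (i ∸ e) e)) (cong (2 ^_) (m∸n+n≡m e≤i))

2^i≤2^[1+i]∸2^[i∸e] : ∀ i e → 2 ^ i ≤ 2 ^ suc i ∸ 2 ^ (i ∸ e)
2^i≤2^[1+i]∸2^[i∸e] i e = begin
  2 ^ i                               ≤⟨ m≤m+n (2 ^ i) _ ⟩
  2 ^ i + (2 ^ i + 0 ∸ 2 ^ (i ∸ e))   ≡⟨ +-∸-assoc (2 ^ i) 2^[i∸e]≤2^i+0 ⟨
  2 ^ suc i ∸ 2 ^ (i ∸ e)             ∎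
  where
  open ≤-Reasoning
  2^[i∸e]≤2^i+0 : 2 ^ (i ∸ e) ≤ 2 ^ i + 0
  2^[i∸e]≤2^i+0 = ≤-trans (^-monoʳ-≤ 2 (m∸n≤m i e)) (m≤m+n (2 ^ i) 0)

InLast⇒InBlock : ∀ {e i n} → InLast e i n → InBlock i n
InLast⇒InBlock {e} {i} (tail≤n , n<2^[1+i]) = ≤-trans (2^i≤2^[1+i]∸2^[i∸e] i e) tail≤n , n<2^[1+i]

InBlock-unique : ∀ {i j n} → InBlock i n → InBlock j n → i ≡ j
InBlock-unique (2^i≤n , n<2^[1+i]) (2^j≤n , n<2^[1+j]) = ≤-antisym (below 2^i≤n n<2^[1+j]) (below 2^j≤n n<2^[1+i])
  where
  below : ∀ {i j n} → 2 ^ i ≤ n → n < 2 ^ suc j → i ≤ j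
  below 2^i≤n n<2^[1+j] = ≮⇒≥ (λ j<i → <⇒≱ n<2^[1+j] (≤-trans (^-monoʳ-≤ 2 j<i) 2^i≤n))

ThinBlocksFrom : Subset → ℕ → ℕ → Set
ThinBlocksFrom Y f J = ∀ j → J ≤ j → count Y (2 ^ suc j) ≤ 2 ^ (j ∸ f) + count Y (2 ^ j)

count-at-powers : ∀ Y {f J} → f ≤ J → ThinBlocksFrom Y f J →
  ∀ d → count Y (2 ^ (d + J)) * 2 ^ f ≤ 2 ^ (J + f) + 2 ^ (d + J)
count-at-powers Y {f} {J} f≤J thin zero = begin
  count Y (2 ^ J) * 2 ^ f  ≤⟨ *-monoˡ-≤ (2 ^ f) (count-≤ Y (2 ^ J)) ⟩
  2 ^ J * 2 ^ f            ≡⟨ ^-distribˡ-+-* 2 J f ⟨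
  2 ^ (J + f)              ≤⟨ m≤m+n (2 ^ (J + f)) (2 ^ J) ⟩
  2 ^ (J + f) + 2 ^ J      ∎
  where open ≤-Reasoning
count-at-powers Y {f} {J} f≤J thin (suc d) = begin
  count Y (2 ^ suc j) * 2 ^ f                    ≤⟨ *-monoˡ-≤ (2 ^ f) (thin j (m≤n+m J d)) ⟩
  (2 ^ (j ∸ f) + count Y (2 ^ j)) * 2 ^ f        ≡⟨ *-distribʳ-+ (2 ^ f) (2 ^ (j ∸ f)) _ ⟩
  2 ^ (j ∸ f) * 2 ^ f + count Y (2 ^ j) * 2 ^ f  ≡⟨ cong (_+ count Y (2 ^ j) * 2 ^ f) (2^[i∸e]*2^e≡2^i f≤j) ⟩
  2 ^ j + count Y (2 ^ j) * 2 ^ f                ≤⟨ +-monoʳ-≤ (2 ^ j) (count-at-powers Y f≤J thin d) ⟩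
  2 ^ j + (2 ^ (J + f) + 2 ^ j)                  ≡⟨ solve 2 (λ x y → x :+ (y :+ x) := y :+ con 2 :* x) refl (2 ^ j) (2 ^ (J + f)) ⟩
  2 ^ (J + f) + 2 ^ suc j                        ∎
  where
  open ≤-Reasoning
  open +-*-Solver
  j = d + J
  f≤j : f ≤ j
  f≤j = ≤-trans f≤J (m≤n+m J d)

dyadic-cover : ∀ J {M} d → 2 ^ J ≤ M → M ≤ 2 ^ (d + J) → ∃[ d′ ] M ≤ 2 ^ (d′ + J) × 2 ^ (d′ + J) ≤ 2 * M
dyadic-cover J {M} zero    2^J≤M M≤2^J = 0 , M≤2^J , ≤-trans 2^J≤M (m≤m+n M (M + 0))
dyadic-cover J {M} (suc d) 2^J≤M M≤2^[1+d+J] with M ≤? 2 ^ (d + J)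
... | yes M≤2^[d+J] = dyadic-cover J d 2^J≤M M≤2^[d+J]
... | no  M≰2^[d+J] = suc d , M≤2^[1+d+J] , *-monoʳ-≤ 2 (<⇒≤ (≰⇒> M≰2^[d+J]))

count-bound : ∀ Y {f J} → f ≤ J → ThinBlocksFrom Y f J →
  ∀ M → 2 ^ J ≤ M → count Y M * 2 ^ f ≤ 2 ^ (J + f) + 2 * M
count-bound Y {f} {J} f≤J thin M 2^J≤M with dyadic-cover J M 2^J≤M (≤-trans (<⇒≤ (n<2^n M)) (^-monoʳ-≤ 2 (m≤m+n M J)))
... | d , M≤2^[d+J] , 2^[d+J]≤2M = begin
  count Y M * 2 ^ f                ≤⟨ *-monoˡ-≤ (2 ^ f) (count-mono Y M≤2^[d+J]) ⟩
  count Y (2 ^ (d + J)) * 2 ^ f    ≤⟨ count-at-powers Y f≤J thin d ⟩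
  2 ^ (J + f) + 2 ^ (d + J)        ≤⟨ +-monoʳ-≤ (2 ^ (J + f)) 2^[d+J]≤2M ⟩
  2 ^ (J + f) + 2 * M              ∎
  where open ≤-Reasoning

-- Gaps

Gap⇒2^[i∸e]≤count-∁ : ∀ {X e i} → Gap X e i → 2 ^ (i ∸ e) ≤ count (∁ X) (2 ^ suc i)
Gap⇒2^[i∸e]≤count-∁ {X} {e} {i} (_ , empty) = begin
  L                     ≤⟨ m≤m+n L _ ⟩
  L + count (∁ X) T     ≡⟨ count-true-on (∁ X) L T in-tail ⟨
  count (∁ X) (L + T)   ≡⟨ cong (count (∁ X)) (m+[n∸m]≡n L≤M) ⟩
  count (∁ X) M         ∎
  where
  open ≤-Reasoning
  L = 2 ^ (i ∸ e)
  M = 2 ^ suc i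
  T = M ∸ L
  L≤M : L ≤ M
  L≤M = 2^[i∸e]≤2^[1+i] i e
  in-tail : ∀ n → T ≤ n → n < L + T → ∁ X n ≡ true
  in-tail n T≤n n<L+T = cong not (empty n (T≤n , subst (n <_) (m+[n∸m]≡n L≤M) n<L+T))

Density0-∁⇒FinitelyManyGaps : ∀ {X} → Density0 (∁ X) → ∀ e → FinitelyManyGaps X e
Density0-∁⇒FinitelyManyGaps {X} d0 e with d0 (2 ^ suc e)
... | N , sparse = N , λ i gap → ≰⇒> (λ N≤i → <⇒≱ (sparse (2 ^ suc i) (N≤2^[1+i] N≤i)) (crowded i gap))
  where
  N≤2^[1+i] : ∀ {i} → N ≤ i → N ≤ 2 ^ suc i
  N≤2^[1+i] {i} N≤i = ≤-trans N≤i (≤-trans (n≤1+n i) (<⇒≤ (n<2^n (suc i))))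
  crowded : ∀ i → Gap X e i → 2 ^ suc i ≤ count (∁ X) (2 ^ suc i) * suc (2 ^ suc e)
  crowded i gap@(e≤i , _) = begin
    2 ^ suc i                                  ≡⟨ 2^[i∸e]*2^e≡2^i (s≤s e≤i) ⟨
    2 ^ (i ∸ e) * 2 ^ suc e                    ≤⟨ *-monoˡ-≤ (2 ^ suc e) (Gap⇒2^[i∸e]≤count-∁ gap) ⟩
    count (∁ X) (2 ^ suc i) * 2 ^ suc e        ≤⟨ *-monoʳ-≤ (count (∁ X) (2 ^ suc i)) (n≤1+n _) ⟩
    count (∁ X) (2 ^ suc i) * suc (2 ^ suc e)  ∎
    where open ≤-Reasoning

LargeGapsBefore : Subset → ℕ → ℕ → Set
LargeGapsBefore X f J = ∀ e i → e < f → Gap X e i → i < J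

FinitelyManyGaps⇒LargeGapsBefore : ∀ {X} → (∀ e → FinitelyManyGaps X e) → ∀ f → ∃[ J ] LargeGapsBefore X f J
FinitelyManyGaps⇒LargeGapsBefore finite zero = 0 , λ _ _ ()
FinitelyManyGaps⇒LargeGapsBefore {X} finite (suc f) with FinitelyManyGaps⇒LargeGapsBefore finite f | finite f
... | J , before | B , at = J + B , bound
  where
  bound : LargeGapsBefore X (suc f) (J + B)
  bound e i e<1+f gap with m<1+n⇒m<n∨m≡n e<1+f
  ... | inj₁ e<f  = ≤-trans (before e i e<f gap) (m≤m+n J B)
  ... | inj₂ refl = ≤-trans (at i gap) (m≤n+m B J)

module _ {X : Subset} (cover : GapsCoverComplement X) {f J : ℕ} (before : LargeGapsBefore X f J) where

  ∁-in-tail : ∀ {j n} → J ≤ j → InBlock j n → X n ≡ false → InLast f j n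
  ∁-in-tail {j} J≤j blk Xn≡false with cover _ Xn≡false
  ... | e , i , gap@(e≤i , _) , (tail≤n , n<2^[1+i])
      with InBlock-unique {i} {j} (InLast⇒InBlock {e} (tail≤n , n<2^[1+i])) blk
  ...   | refl = ≤-trans (∸-monoʳ-≤ (2 ^ suc i) (^-monoʳ-≤ 2 (∸-monoʳ-≤ i f≤e))) tail≤n , n<2^[1+i]
    where
    f≤e : f ≤ e
    f≤e = ≮⇒≥ (λ e<f → <⇒≱ (before e i e<f gap) J≤j)

  X-before-tail : ∀ {j n} → J ≤ j → 2 ^ j ≤ n → n < 2 ^ suc j ∸ 2 ^ (j ∸ f) → X n ≡ true
  X-before-tail {j} {n} J≤j 2^j≤n n<tail with X n in Xn
  ... | true  = refl
  ... | false = contradiction (proj₁ (∁-in-tail J≤j (2^j≤n , ≤-trans n<tail (m∸n≤m (2 ^ suc j) (2 ^ (j ∸ f)))) Xn)) (<⇒≱ n<tail)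

  count-∁-block-growth : ∀ {j} → J ≤ j → count (∁ X) (2 ^ suc j) ≤ 2 ^ (j ∸ f) + count (∁ X) (2 ^ j)
  count-∁-block-growth {j} J≤j = begin
    count (∁ X) (2 ^ suc j)    ≡⟨ cong (count (∁ X)) (m+[n∸m]≡n (2^[i∸e]≤2^[1+i] j f)) ⟨
    count (∁ X) (L + T)        ≤⟨ count-+-≤ (∁ X) L T ⟩
    L + count (∁ X) T          ≡⟨ cong (_+_ L) (cong (count (∁ X)) (m∸n+n≡m 2^j≤T)) ⟨
    L + count (∁ X) (H + 2 ^ j) ≡⟨ cong (_+_ L) (count-false-on (∁ X) H (2 ^ j) head) ⟩
    L + count (∁ X) (2 ^ j)    ∎
    where
    open ≤-Reasoning
    L = 2 ^ (j ∸ f)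
    T = 2 ^ suc j ∸ L
    2^j≤T : 2 ^ j ≤ T
    2^j≤T = 2^i≤2^[1+i]∸2^[i∸e] j f
    H = T ∸ 2 ^ j
    head : ∀ n → 2 ^ j ≤ n → n < H + 2 ^ j → ∁ X n ≡ false
    head n 2^j≤n n<T = cong not (X-before-tail J≤j 2^j≤n (subst (n <_) (m∸n+n≡m 2^j≤T) n<T))

FinitelyManyGaps⇒Density0-∁ : ∀ {X} → GapsCoverComplement X → (∀ e → FinitelyManyGaps X e) → Density0 (∁ X)
FinitelyManyGaps⇒Density0-∁ {X} cover finite k with FinitelyManyGaps⇒LargeGapsBefore finite (3 + k)
... | J₀ , before = suc (2 ^ (J + f)) , sparse
  where
  -- 2^f ≥ 4 (1+k) leaves room for the terms 2^(J+f) < n and 2n of count-bound.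
  f = 3 + k
  J = J₀ + f
  thin : ThinBlocksFrom (∁ X) f J
  thin j J≤j = count-∁-block-growth cover before (≤-trans (m≤m+n J₀ f) J≤j)
  4[1+k]≤2^f : 4 * suc k ≤ 2 ^ f
  4[1+k]≤2^f = ≤-trans (*-monoʳ-≤ 4 (<⇒≤ (n<2^n (suc k)))) (≤-reflexive (*-assoc 2 2 (2 ^ suc k)))
  sparse : ∀ n → suc (2 ^ (J + f)) ≤ n → count (∁ X) n * suc k < n
  sparse n 2^[J+f]<n = *-cancelˡ-< 4 (c * suc k) n (begin-strict
    4 * (c * suc k)      ≡⟨ *-assoc 4 c (suc k) ⟨
    4 * c * suc k        ≡⟨ cong (_* suc k) (*-comm 4 c) ⟩
    c * 4 * suc k        ≡⟨ *-assoc c 4 (suc k) ⟩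
    c * (4 * suc k)      ≤⟨ *-monoʳ-≤ c 4[1+k]≤2^f ⟩
    c * 2 ^ f            ≤⟨ count-bound (∁ X) (m≤n+m f J₀) thin n 2^J≤n ⟩
    2 ^ (J + f) + 2 * n  <⟨ +-monoˡ-< (2 * n) 2^[J+f]<n ⟩
    3 * n                ≤⟨ *-monoˡ-≤ n (n≤1+n 3) ⟩
    4 * n                ∎)
    where
    open ≤-Reasoning
    c = count (∁ X) n
    2^J≤n : 2 ^ J ≤ n
    2^J≤n = ≤-trans (^-monoʳ-≤ 2 (m≤m+n J f)) (≤-trans (n≤1+n _) 2^[J+f]<n)

mainTheorem4 : (X : Subset) → GapsCoverComplement X →
    (Density1 X ⇔ (∀ (e : ℕ) → FinitelyManyGaps X e))
mainTheorem4 X cover = mk⇔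
  (Density0-∁⇒FinitelyManyGaps ∘ to)
  (from ∘ FinitelyManyGaps⇒Density0-∁ cover)
  where open Equivalence (Density1⇔Density0-∁ X)
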